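{- Let $E$ be the ground set of $M(K_4)$, let $A\subseteq E$, and let $\rho_A$ be the $2$-polymatroid on $E$ given by $\rho_A(X)=r_{M(K_4)}(X)+|X\cap A|$. Let $M_{\rho_A}$ be its natural matroid on $X_E$. For $S\subseteq X_E$ let $S'=\{e\in E:|S\cap X_e|=\rho_A(\{e\})\}$. Then $S$ is independent in $M_{\rho_A}$ if and only if $S'$ is independent in $M(K_4)$. Moreover, $S$ is a basis of $M_{\rho_A}$ if and only if $S'$ is a basis of $M(K_4)$ and $X_e\cap S\neq\emptyset$ for each $e\in A$.
   Context: Natural matroid of a polymatroid $(E,\rho)$ (with $\rho:2^E\to\mathbb{Z}$ normalized, nondecreasing, submodular): take pairwise disjoint sets $X_e$ with $|X_e|=\rho(\{e\})$, put $X_D=\bigcup_{e\in D}X_e$, and let $M_\rho$ be the matroid on $X_E$ with rank $r(X)=\min\{\rho(D)+|X-X_D|:D\subseteq E\}$. -}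

module Defs where

open import Data.Bool using (Bool; true; false; _∧_; _∨_; not; if_then_else_)
open import Data.Nat using (ℕ; zero; suc; _+_; _∸_; _⊓_; _≡ᵇ_; _<ᵇ_)
open import Data.Fin using (Fin; zero; suc; _≟_; toℕ)
open import Data.Fin.Subset using (Subset; ⁅_⁆; ⊥; ⊤; ∣_∣; _∩_)
open import Data.Vec using (Vec; []; _∷_; lookup; tabulate)
open import Data.List using (List; []; _∷_; map; _++_; foldr)
open import Data.Product using (Σ; _×_; _,_; proj₁; proj₂)
open import Relation.Nullary.Decidable using (⌊_⌋)
open import Relation.Binary.PropositionalEquality using (_≡_; refl)

anyF : ∀ {n} → (Fin n → Bool) → Bool
anyF {zero}  f = false
anyF {suc n} f = f zero ∨ anyF (λ i → f (suc i))

sumF : ∀ {n} → (Fin n → ℕ) → ℕ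
sumF {zero}  f = 0
sumF {suc n} f = f zero + sumF (λ i → f (suc i))

countF : ∀ {n} → (Fin n → Bool) → ℕ
countF f = sumF (λ i → if f i then 1 else 0)

subsets : (n : ℕ) → List (Subset n)
subsets zero    = [] ∷ []
subsets (suc n) = map (true ∷_) (subsets n) ++ map (false ∷_) (subsets n)

module CycleMatroid {v m : ℕ} (ends : Fin m → Fin v × Fin v) where

  eqF : Fin v → Fin v → Bool
  eqF a b = ⌊ a ≟ b ⌋

  adj : Subset m → Fin v → Fin v → Bool
  adj X u w = anyF (λ e → lookup X e ∧
                ((eqF (proj₁ (ends e)) u ∧ eqF (proj₂ (ends e)) w) ∨
                 (eqF (proj₁ (ends e)) w ∧ eqF (proj₂ (ends e)) u)))

  reachWithin : ℕ → Subset m → Fin v → Fin v → Bool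
  reachWithin zero    X u w = eqF u w
  reachWithin (suc k) X u w =
    reachWithin k X u w ∨ anyF (λ z → reachWithin k X u z ∧ adj X z w)

  -- connected in (V , X): walks of length ≤ |V| suffice
  connected : Subset m → Fin v → Fin v → Bool
  connected X = reachWithin v X

  -- a component is counted by its least vertex
  components : Subset m → ℕ
  components X = countF (λ w → not (anyF (λ u → (toℕ u <ᵇ toℕ w) ∧ connected X u w)))

  rank : Subset m → ℕ
  rank X = v ∸ components X

  Independent : Subset m → Set
  Independent X = rank X ≡ ∣ X ∣

  Basis : Subset m → Set
  Basis X = Independent X × (rank X ≡ rank ⊤)

K4ends : Fin 6 → Fin 4 × Fin 4
K4ends zero                               = zero , suc zero
K4ends (suc zero)                         = zero , suc (suc zero)
K4ends (suc (suc zero))                   = zero , suc (suc (suc zero))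
K4ends (suc (suc (suc zero)))             = suc zero , suc (suc zero)
K4ends (suc (suc (suc (suc zero))))       = suc zero , suc (suc (suc zero))
K4ends (suc (suc (suc (suc (suc zero))))) = suc (suc zero) , suc (suc (suc zero))

module MK4 = CycleMatroid K4ends

-- Natural matroid of a set function ρ on Subset m.
-- X_e = Fin (ρ {e}) (tagged by e, so pairwise disjoint); X_E is the Σ-type.
-- Subsets of X_E are Bool-valued predicates.

module NaturalMatroid {m : ℕ} (ρ : Subset m → ℕ) where

  XE : Set
  XE = Σ (Fin m) (λ e → Fin (ρ ⁅ e ⁆))

  SubsetX : Set
  SubsetX = XE → Bool

  block : SubsetX → Fin m → ℕ
  block S e = countF (λ i → S (e , i))

  card : SubsetX → ℕ
  card S = sumF (block S)

  cardMinus : SubsetX → Subset m → ℕ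
  cardMinus S D = sumF (λ e → if lookup D e then 0 else block S e)

  rank : SubsetX → ℕ
  rank S = foldr (λ D acc → (ρ D + cardMinus S D) ⊓ acc)
                 (ρ ⊥ + cardMinus S ⊥) (subsets m)

  fullX : SubsetX
  fullX _ = true

  Independent : SubsetX → Set
  Independent S = rank S ≡ card S

  Basis : SubsetX → Set
  Basis S = Independent S × (rank S ≡ rank fullX)

  S′ : SubsetX → Subset m
  S′ S = tabulate (λ e → block S e ≡ᵇ ρ ⁅ e ⁆)

ρ : Subset 6 → Subset 6 → ℕ
ρ A X = MK4.rank X + ∣ X ∩ A ∣

private
  _ : MK4.rank ⊤ ≡ 3
  _ = refl
  _ : MK4.rank (true ∷ true ∷ false ∷ true ∷ false ∷ false ∷ []) ≡ 2
  _ = refl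
  _ : MK4.rank (true ∷ false ∷ false ∷ false ∷ false ∷ true ∷ []) ≡ 2
  _ = refl
  _ : NaturalMatroid.rank (ρ ⊤) (NaturalMatroid.fullX (ρ ⊤)) ≡ 9
  _ = refl

-- Only two facts about M(K4) are used: its rank function r is a matroid rank function, and it has
-- no loops, so ρ_A({e}) = 1 + [e ∈ A]. Hence every block satisfies |S ∩ X_e| ≤ [e ∈ S'] + [e ∈ A],
-- so |S ∩ X_D| ≤ |D ∩ S'| + |D ∩ A| ≤ ρ_A(D) whenever S' is independent. As S is independent iff
-- |S ∩ X_D| ≤ ρ_A(D) for all D, this is one direction; D = S' gives |S'| ≤ r(S') for the other.
-- The natural matroid has rank r(E) + |A|, and for independent S the chain
-- |S| ≤ |S'| + |A| ≤ r(E) + |A| is tight iff S' spans and every X_e with e ∈ A meets S.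
module Submission where

open import Defs
open import Data.Fin using (Fin)
open import Data.Fin.Subset using (Subset; _∈_)
open import Data.Bool using (Bool; true)
open import Data.Product using (_×_; _,_; ∃-syntax)
open import Function.Bundles using (_⇔_)
open import Relation.Binary.PropositionalEquality using (_≡_)

open import Data.Product using (proj₁; proj₂)
open import Data.Bool using (false; if_then_else_)
open import Data.Bool.ListAction using (any)
import Data.Bool.Properties as Bool
open import Data.Fin using (zero; suc)
open import Data.Fin.Properties using (all?)
open import Data.Fin.Subset using (⁅_⁆; ⊥; ⊤; ∣_∣; _∩_; _∪_; _─_; _⊆_)
open import Data.Fin.Subset.Properties using (_⊆?_; ⊆⊤; p∩q⊆p; ∩-identityˡ; ∩-identityʳ; ∩-zeroˡ; ∣⊥∣≡0)
open import Data.List using (List; []; _∷_; foldr; map)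
open import Data.List.Membership.Propositional using () renaming (_∈_ to _∈ₗ_)
open import Data.List.Membership.Propositional.Properties using (∈-++⁺ˡ; ∈-++⁺ʳ; ∈-map⁺)
open import Data.List.Relation.Unary.Any using (here; there)
open import Data.Nat using (ℕ; zero; suc; _+_; _∸_; _⊓_; _≡ᵇ_; _≤_; _<_; _≟_; _≤?_; z≤n; s≤s)
open import Data.Nat.Properties
open import Algebra.Properties.CommutativeSemigroup +-commutativeSemigroup using (interchange)
open import Data.Vec using ([]; _∷_; lookup)
open import Data.Vec.Properties using (lookup∘tabulate; lookup-replicate; ≡-dec; []=⇒lookup; lookup⇒[]=)
open import Function using (_∘_; case_of_)
open import Function.Bundles using (mk⇔; Equivalence)
open import Function.Properties.Equivalence using () renaming (trans to ⇔-trans)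
open import Relation.Nullary using (Dec)
open import Relation.Nullary.Decidable using (⌊_⌋; toWitness; map′; _×-dec_; _→-dec_)
open import Relation.Unary using (Decidable)
open import Relation.Binary.PropositionalEquality using (refl; sym; trans; cong; cong₂; subst; subst₂; module ≡-Reasoning)

𝟙 : Bool → ℕ
𝟙 b = if b then 1 else 0

indicator : ∀ {n} → Subset n → Fin n → ℕ
indicator X = 𝟙 ∘ lookup X

sumIn sumOut : ∀ {n} → Subset n → (Fin n → ℕ) → ℕ
sumIn  D f = sumF (λ i → if lookup D i then f i else 0)
sumOut D f = sumF (λ i → if lookup D i then 0 else f i)

sumF-cong : ∀ {n} {f g : Fin n → ℕ} → (∀ i → f i ≡ g i) → sumF f ≡ sumF g
sumF-cong {zero}  f≗g = refl
sumF-cong {suc n} f≗g = cong₂ _+_ (f≗g zero) (sumF-cong (f≗g ∘ suc))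

sumF-mono-≤ : ∀ {n} {f g : Fin n → ℕ} → (∀ i → f i ≤ g i) → sumF f ≤ sumF g
sumF-mono-≤ {zero}  f≤g = z≤n
sumF-mono-≤ {suc n} f≤g = +-mono-≤ (f≤g zero) (sumF-mono-≤ (f≤g ∘ suc))

sumF-+ : ∀ {n} (f g : Fin n → ℕ) → sumF (λ i → f i + g i) ≡ sumF f + sumF g
sumF-+ {zero}  f g = refl
sumF-+ {suc n} f g = trans (cong (f zero + g zero +_) (sumF-+ (f ∘ suc) (g ∘ suc)))
                           (interchange (f zero) (g zero) (sumF (f ∘ suc)) (sumF (g ∘ suc)))

sumF-0 : ∀ n → sumF {n} (λ _ → 0) ≡ 0
sumF-0 zero    = refl
sumF-0 (suc n) = sumF-0 n

+-≤-≡⇒≡ : ∀ {a b c d} → a ≤ b → c ≤ d → a + c ≡ b + d → a ≡ b × c ≡ d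
+-≤-≡⇒≡ {a} {b} {c} {d} a≤b c≤d eq = a≡b , +-cancelˡ-≡ a c d (trans eq (cong (_+ d) (sym a≡b)))
  where
  open ≤-Reasoning
  a≡b : a ≡ b
  a≡b = ≤-antisym a≤b (+-cancelʳ-≤ d b a (begin
    b + d ≡⟨ sym eq ⟩
    a + c ≤⟨ +-monoʳ-≤ a c≤d ⟩
    a + d ∎))

sumF-≡⇒≡ : ∀ {n} {f g : Fin n → ℕ} → (∀ i → f i ≤ g i) → sumF f ≡ sumF g → ∀ i → f i ≡ g i
sumF-≡⇒≡ {suc n} f≤g eq zero    = proj₁ (+-≤-≡⇒≡ (f≤g zero) (sumF-mono-≤ (f≤g ∘ suc)) eq)
sumF-≡⇒≡ {suc n} f≤g eq (suc i) = sumF-≡⇒≡ (f≤g ∘ suc) (proj₂ (+-≤-≡⇒≡ (f≤g zero) (sumF-mono-≤ (f≤g ∘ suc)) eq)) i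

countF-≤ : ∀ {n} (f : Fin n → Bool) → countF f ≤ n
countF-≤ {zero}  f = z≤n
countF-≤ {suc n} f with f zero
... | true  = s≤s (countF-≤ (f ∘ suc))
... | false = m≤n⇒m≤1+n (countF-≤ (f ∘ suc))

countF-true : ∀ n → countF {n} (λ _ → true) ≡ n
countF-true zero    = refl
countF-true (suc n) = cong suc (countF-true n)

0<countF⇔∃ : ∀ {n} (f : Fin n → Bool) → 0 < countF f ⇔ (∃[ i ] f i ≡ true)
0<countF⇔∃ f = mk⇔ (to f) (from f)
  where
  to : ∀ {n} (f : Fin n → Bool) → 0 < countF f → ∃[ i ] f i ≡ true
  to {suc n} f pos with f zero in eq
  ... | true  = zero , eq
  ... | false = let i , fi = to (f ∘ suc) pos in suc i , fi
  from : ∀ {n} (f : Fin n → Bool) → ∃[ i ] f i ≡ true → 0 < countF f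
  from {suc n} f (zero , f0) rewrite f0 = s≤s z≤n
  from {suc n} f (suc i , fi) with f zero
  ... | true  = s≤s z≤n
  ... | false = from (f ∘ suc) (i , fi)

sumF-split : ∀ {n} (D : Subset n) (f : Fin n → ℕ) → sumF f ≡ sumIn D f + sumOut D f
sumF-split D f = trans (sumF-cong split)
  (sumF-+ (λ i → if lookup D i then f i else 0) (λ i → if lookup D i then 0 else f i))
  where
  split : ∀ i → f i ≡ (if lookup D i then f i else 0) + (if lookup D i then 0 else f i)
  split i with lookup D i
  ... | true  = sym (+-identityʳ (f i))
  ... | false = refl

sumIn-+ : ∀ {n} (D : Subset n) (f g : Fin n → ℕ) → sumIn D (λ i → f i + g i) ≡ sumIn D f + sumIn D g
sumIn-+ D f g = trans (sumF-cong distrib)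
  (sumF-+ (λ i → if lookup D i then f i else 0) (λ i → if lookup D i then g i else 0))
  where
  distrib : ∀ i → (if lookup D i then f i + g i else 0)
                ≡ (if lookup D i then f i else 0) + (if lookup D i then g i else 0)
  distrib i with lookup D i
  ... | true  = refl
  ... | false = refl

sumOut-+ : ∀ {n} (D : Subset n) (f g : Fin n → ℕ) → sumOut D (λ i → f i + g i) ≡ sumOut D f + sumOut D g
sumOut-+ D f g = trans (sumF-cong distrib)
  (sumF-+ (λ i → if lookup D i then 0 else f i) (λ i → if lookup D i then 0 else g i))
  where
  distrib : ∀ i → (if lookup D i then 0 else f i + g i)
                ≡ (if lookup D i then 0 else f i) + (if lookup D i then 0 else g i)
  distrib i with lookup D i
  ... | true  = refl
  ... | false = refl

sumIn-mono-≤ : ∀ {n} (D : Subset n) {f g : Fin n → ℕ} → (∀ i → f i ≤ g i) → sumIn D f ≤ sumIn D g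
sumIn-mono-≤ D {f} {g} f≤g = sumF-mono-≤ mono
  where
  mono : ∀ i → (if lookup D i then f i else 0) ≤ (if lookup D i then g i else 0)
  mono i with lookup D i
  ... | true  = f≤g i
  ... | false = z≤n

sumIn-cong : ∀ {n} (D : Subset n) {f g : Fin n → ℕ} →
             (∀ i → lookup D i ≡ true → f i ≡ g i) → sumIn D f ≡ sumIn D g
sumIn-cong D {f} {g} f≗g = sumF-cong eq
  where
  eq : ∀ i → (if lookup D i then f i else 0) ≡ (if lookup D i then g i else 0)
  eq i with lookup D i in Di
  ... | true  = f≗g i Di
  ... | false = refl

sumIn-⁅⁆ : ∀ {n} (i : Fin n) (f : Fin n → ℕ) → sumIn ⁅ i ⁆ f ≡ f i
sumIn-⁅⁆ {suc n} zero    f = begin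
  f zero + sumF (λ j → if lookup ⊥ j then f (suc j) else 0) ≡⟨ cong (f zero +_) (sumF-cong outside) ⟩
  f zero + sumF {n} (λ _ → 0)                              ≡⟨ cong (f zero +_) (sumF-0 n) ⟩
  f zero + 0                                               ≡⟨ +-identityʳ (f zero) ⟩
  f zero                                                   ∎
  where
  open ≡-Reasoning
  outside : ∀ j → (if lookup ⊥ j then f (suc j) else 0) ≡ 0
  outside j rewrite lookup-replicate j false = refl
sumIn-⁅⁆ {suc n} (suc i) f = sumIn-⁅⁆ i (f ∘ suc)

sumOut-⊥ : ∀ {n} (f : Fin n → ℕ) → sumOut ⊥ f ≡ sumF f
sumOut-⊥ f = sumF-cong λ i → cong (λ b → if b then 0 else f i) (lookup-replicate i false)

sumOut-⊤ : ∀ {n} (f : Fin n → ℕ) → sumOut ⊤ f ≡ 0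
sumOut-⊤ {n} f = trans (sumF-cong λ i → cong (λ b → if b then 0 else f i) (lookup-replicate i true)) (sumF-0 n)

∣∣≡sumF : ∀ {n} (X : Subset n) → ∣ X ∣ ≡ sumF (indicator X)
∣∣≡sumF []          = refl
∣∣≡sumF (true ∷ X)  = cong suc (∣∣≡sumF X)
∣∣≡sumF (false ∷ X) = ∣∣≡sumF X

∣∩∣≡sumIn : ∀ {n} (D X : Subset n) → ∣ D ∩ X ∣ ≡ sumIn D (indicator X)
∣∩∣≡sumIn D X = trans (∣∣≡sumF (D ∩ X)) (sumF-cong (pointwise D X))
  where
  pointwise : ∀ {n} (D X : Subset n) i → indicator (D ∩ X) i ≡ (if lookup D i then indicator X i else 0)
  pointwise (true  ∷ D) (x ∷ X) zero    = refl
  pointwise (false ∷ D) (x ∷ X) zero    = refl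
  pointwise (d ∷ D)     (x ∷ X) (suc i) = pointwise D X i

∣─∣≡sumOut : ∀ {n} (X D : Subset n) → ∣ X ─ D ∣ ≡ sumOut D (indicator X)
∣─∣≡sumOut X D = trans (∣∣≡sumF (X ─ D)) (sumF-cong (pointwise X D))
  where
  pointwise : ∀ {n} (X D : Subset n) i → indicator (X ─ D) i ≡ (if lookup D i then 0 else indicator X i)
  pointwise (x ∷ X) (true  ∷ D) zero    = refl
  pointwise (x ∷ X) (false ∷ D) zero    = refl
  pointwise (x ∷ X) (d ∷ D)     (suc i) = pointwise X D i

∣∣≡∣∩∣+∣─∣ : ∀ {n} (D X : Subset n) → ∣ X ∣ ≡ ∣ D ∩ X ∣ + ∣ X ─ D ∣
∣∣≡∣∩∣+∣─∣ D X = begin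
  ∣ X ∣                                            ≡⟨ ∣∣≡sumF X ⟩
  sumF (indicator X)                               ≡⟨ sumF-split D (indicator X) ⟩
  sumIn D (indicator X) + sumOut D (indicator X)   ≡⟨ sym (cong₂ _+_ (∣∩∣≡sumIn D X) (∣─∣≡sumOut X D)) ⟩
  ∣ D ∩ X ∣ + ∣ X ─ D ∣                            ∎
  where open ≡-Reasoning

∩∪─≡ : ∀ {n} (D X : Subset n) → (D ∩ X) ∪ (X ─ D) ≡ X
∩∪─≡ []          []          = refl
∩∪─≡ (true  ∷ D) (true  ∷ X) = cong (true ∷_)  (∩∪─≡ D X)
∩∪─≡ (true  ∷ D) (false ∷ X) = cong (false ∷_) (∩∪─≡ D X)
∩∪─≡ (false ∷ D) (true  ∷ X) = cong (true ∷_)  (∩∪─≡ D X)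
∩∪─≡ (false ∷ D) (false ∷ X) = cong (false ∷_) (∩∪─≡ D X)

∩∩─≡⊥ : ∀ {n} (D X : Subset n) → (D ∩ X) ∩ (X ─ D) ≡ ⊥
∩∩─≡⊥ []          []          = refl
∩∩─≡⊥ (true  ∷ D) (true  ∷ X) = cong (false ∷_) (∩∩─≡⊥ D X)
∩∩─≡⊥ (true  ∷ D) (false ∷ X) = cong (false ∷_) (∩∩─≡⊥ D X)
∩∩─≡⊥ (false ∷ D) (x     ∷ X) = cong (false ∷_) (∩∩─≡⊥ D X)

record IsMatroidRank {n} (r : Subset n → ℕ) : Set where
  field
    bounded    : ∀ X → r X ≤ ∣ X ∣
    monotone   : ∀ {X Y} → X ⊆ Y → r X ≤ r Y
    submodular : ∀ X Y → r (X ∪ Y) + r (X ∩ Y) ≤ r X + r Y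

  r⊥≡0 : r ⊥ ≡ 0
  r⊥≡0 = n≤0⇒n≡0 (subst (r ⊥ ≤_) (∣⊥∣≡0 n) (bounded ⊥))

  r≤r∩+∣─∣ : ∀ D X → r X ≤ r (D ∩ X) + ∣ X ─ D ∣
  r≤r∩+∣─∣ D X = begin
    r X                                          ≡⟨ sym (+-identityʳ (r X)) ⟩
    r X + 0                                      ≡⟨ cong (r X +_) (sym r⊥≡0) ⟩
    r X + r ⊥                                    ≡⟨ sym (cong₂ (λ U V → r U + r V) (∩∪─≡ D X) (∩∩─≡⊥ D X)) ⟩
    r ((D ∩ X) ∪ (X ─ D)) + r ((D ∩ X) ∩ (X ─ D)) ≤⟨ submodular (D ∩ X) (X ─ D) ⟩
    r (D ∩ X) + r (X ─ D)                        ≤⟨ +-monoʳ-≤ (r (D ∩ X)) (bounded (X ─ D)) ⟩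
    r (D ∩ X) + ∣ X ─ D ∣                        ∎
    where open ≤-Reasoning

  independent⇒∣∩∣≤r : ∀ {X} → r X ≡ ∣ X ∣ → ∀ D → ∣ D ∩ X ∣ ≤ r D
  independent⇒∣∩∣≤r {X} indep D = ≤-trans ∣∩∣≤r∩ (monotone (p∩q⊆p D X))
    where
    ∣∩∣≤r∩ : ∣ D ∩ X ∣ ≤ r (D ∩ X)
    ∣∩∣≤r∩ = +-cancelʳ-≤ ∣ X ─ D ∣ ∣ D ∩ X ∣ (r (D ∩ X))
      (subst (_≤ r (D ∩ X) + ∣ X ─ D ∣) (trans indep (∣∣≡∣∩∣+∣─∣ D X)) (r≤r∩+∣─∣ D X))

IsMatroidRank-cong : ∀ {n} {r r′ : Subset n → ℕ} → (∀ X → r X ≡ r′ X) → IsMatroidRank r → IsMatroidRank r′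
IsMatroidRank-cong r≗r′ isRank = record
  { bounded    = λ X → subst (_≤ ∣ X ∣) (r≗r′ X) (bounded X)
  ; monotone   = λ {X} {Y} X⊆Y → subst₂ _≤_ (r≗r′ X) (r≗r′ Y) (monotone X⊆Y)
  ; submodular = λ X Y → subst₂ _≤_ (cong₂ _+_ (r≗r′ (X ∪ Y)) (r≗r′ (X ∩ Y)))
                                    (cong₂ _+_ (r≗r′ X) (r≗r′ Y)) (submodular X Y)
  }
  where open IsMatroidRank isRank

∈-subsets : ∀ {n} (X : Subset n) → X ∈ₗ subsets n
∈-subsets []          = here refl
∈-subsets (true ∷ X)  = ∈-++⁺ˡ (∈-map⁺ (true ∷_) (∈-subsets X))
∈-subsets (false ∷ X) = ∈-++⁺ʳ (map (true ∷_) (subsets _)) (∈-map⁺ (false ∷_) (∈-subsets X))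

module _ {A : Set} (f : A → ℕ) (z : ℕ) where

  foldr-⊓-≤ : ∀ {x} xs → x ∈ₗ xs → foldr (λ y acc → f y ⊓ acc) z xs ≤ f x
  foldr-⊓-≤ (y ∷ xs) (here refl) = m⊓n≤m (f y) _
  foldr-⊓-≤ (y ∷ xs) (there x∈xs) = ≤-trans (m⊓n≤n (f y) _) (foldr-⊓-≤ xs x∈xs)

  ≤-foldr-⊓ : ∀ {k} xs → k ≤ z → (∀ x → k ≤ f x) → k ≤ foldr (λ y acc → f y ⊓ acc) z xs
  ≤-foldr-⊓ []       k≤z k≤f = k≤z
  ≤-foldr-⊓ (y ∷ xs) k≤z k≤f = ⊓-glb (k≤f y) (≤-foldr-⊓ xs k≤z k≤f)

module NaturalMatroidProperties {m} (ρ : Subset m → ℕ) where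
  open NaturalMatroid ρ

  rank-≤ : ∀ S D → rank S ≤ ρ D + cardMinus S D
  rank-≤ S D = foldr-⊓-≤ (λ D → ρ D + cardMinus S D) _ (subsets m) (∈-subsets D)

  ≤-rank : ∀ S {k} → (∀ D → k ≤ ρ D + cardMinus S D) → k ≤ rank S
  ≤-rank S k≤ = ≤-foldr-⊓ (λ D → ρ D + cardMinus S D) _ (subsets m) (k≤ ⊥) k≤

  -- sumIn D (block S) is |S ∩ X_D|.
  independent⇔sumIn≤ρ : ρ ⊥ ≡ 0 → ∀ S → Independent S ⇔ (∀ D → sumIn D (block S) ≤ ρ D)
  independent⇔sumIn≤ρ ρ⊥≡0 S = mk⇔ to from
    where
    open ≤-Reasoning
    to : Independent S → ∀ D → sumIn D (block S) ≤ ρ D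
    to indep D = +-cancelʳ-≤ (cardMinus S D) (sumIn D (block S)) (ρ D) (begin
      sumIn D (block S) + cardMinus S D ≡⟨ sym (sumF-split D (block S)) ⟩
      card S                            ≡⟨ sym indep ⟩
      rank S                            ≤⟨ rank-≤ S D ⟩
      ρ D + cardMinus S D               ∎)
    rank≤card : rank S ≤ card S
    rank≤card = begin
      rank S                ≤⟨ rank-≤ S ⊥ ⟩
      ρ ⊥ + cardMinus S ⊥   ≡⟨ cong₂ _+_ ρ⊥≡0 (sumOut-⊥ (block S)) ⟩
      card S                ∎
    from : (∀ D → sumIn D (block S) ≤ ρ D) → Independent S
    from fits = ≤-antisym rank≤card (≤-rank S λ D → begin
      card S                            ≡⟨ sumF-split D (block S) ⟩
      sumIn D (block S) + cardMinus S D ≤⟨ +-monoˡ-≤ (cardMinus S D) (fits D) ⟩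
      ρ D + cardMinus S D               ∎)

≤1+𝟙⇒≤𝟙≡ᵇ+𝟙 : ∀ a b → b ≤ suc (𝟙 a) → b ≤ 𝟙 (b ≡ᵇ suc (𝟙 a)) + 𝟙 a
≤1+𝟙⇒≤𝟙≡ᵇ+𝟙 false 0 _ = z≤n
≤1+𝟙⇒≤𝟙≡ᵇ+𝟙 false 1 _ = ≤-refl
≤1+𝟙⇒≤𝟙≡ᵇ+𝟙 true  0 _ = z≤n
≤1+𝟙⇒≤𝟙≡ᵇ+𝟙 true  1 _ = ≤-refl
≤1+𝟙⇒≤𝟙≡ᵇ+𝟙 true  2 _ = ≤-refl
≤1+𝟙⇒≤𝟙≡ᵇ+𝟙 false (suc (suc b)) (s≤s ())
≤1+𝟙⇒≤𝟙≡ᵇ+𝟙 true  (suc (suc (suc b))) (s≤s (s≤s ()))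

≤1+𝟙⇒≡𝟙≡ᵇ+𝟙⇔ : ∀ a b → b ≤ suc (𝟙 a) → b ≡ 𝟙 (b ≡ᵇ suc (𝟙 a)) + 𝟙 a ⇔ (a ≡ true → 0 < b)
≤1+𝟙⇒≡𝟙≡ᵇ+𝟙⇔ false 0 _ = mk⇔ (λ _ ()) (λ _ → refl)
≤1+𝟙⇒≡𝟙≡ᵇ+𝟙⇔ false 1 _ = mk⇔ (λ _ ()) (λ _ → refl)
≤1+𝟙⇒≡𝟙≡ᵇ+𝟙⇔ true  0 _ = mk⇔ (λ ()) (λ nonempty → case nonempty refl of λ ())
≤1+𝟙⇒≡𝟙≡ᵇ+𝟙⇔ true  1 _ = mk⇔ (λ _ _ → s≤s z≤n) (λ _ → refl)
≤1+𝟙⇒≡𝟙≡ᵇ+𝟙⇔ true  2 _ = mk⇔ (λ _ _ → s≤s z≤n) (λ _ → refl)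
≤1+𝟙⇒≡𝟙≡ᵇ+𝟙⇔ false (suc (suc b)) (s≤s ())
≤1+𝟙⇒≡𝟙≡ᵇ+𝟙⇔ true  (suc (suc (suc b))) (s≤s (s≤s ()))

≤+≤-tight⇔ : ∀ {x y a R} → x ≤ y + a → y ≤ R → x ≡ R + a ⇔ (y ≡ R × x ≡ y + a)
≤+≤-tight⇔ {x} {y} {a} {R} x≤y+a y≤R = mk⇔ to from
  where
  to : x ≡ R + a → y ≡ R × x ≡ y + a
  to x≡R+a = y≡R , trans x≡R+a (cong (_+ a) (sym y≡R))
    where
    y≡R = ≤-antisym y≤R (+-cancelʳ-≤ a R y (subst (_≤ y + a) x≡R+a x≤y+a))
  from : y ≡ R × x ≡ y + a → x ≡ R + a
  from (y≡R , x≡y+a) = trans x≡y+a (cong (_+ a) y≡R)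

module NaturalMatroidOfRankPlusCount
  {m} {r : Subset m → ℕ} (isRank : IsMatroidRank r) (loopless : ∀ e → r ⁅ e ⁆ ≡ 1) (A : Subset m)
  (ρA : Subset m → ℕ) (ρA-def : ∀ X → ρA X ≡ r X + ∣ X ∩ A ∣) where

  -- ρA is a parameter rather than a definition so that an instance can pass its own ρ_A verbatim;
  -- a merely definitionally equal ρ_A would make the checker evaluate the natural matroid's rank.

  open IsMatroidRank isRank

  open NaturalMatroid ρA
  open NaturalMatroidProperties ρA

  ρA-⁅⁆ : ∀ e → ρA ⁅ e ⁆ ≡ suc (indicator A e)
  ρA-⁅⁆ e = trans (ρA-def ⁅ e ⁆) (cong₂ _+_ (loopless e) (trans (∣∩∣≡sumIn ⁅ e ⁆ A) (sumIn-⁅⁆ e (indicator A))))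

  ρA-⊥ : ρA ⊥ ≡ 0
  ρA-⊥ = trans (ρA-def ⊥) (cong₂ _+_ r⊥≡0 (trans (cong ∣_∣ (∩-zeroˡ A)) (∣⊥∣≡0 m)))

  rank-fullX : rank fullX ≡ r ⊤ + ∣ A ∣
  rank-fullX = ≤-antisym upper (≤-rank fullX lower)
    where
    open ≤-Reasoning
    upper : rank fullX ≤ r ⊤ + ∣ A ∣
    upper = begin
      rank fullX                          ≤⟨ rank-≤ fullX ⊤ ⟩
      ρA ⊤ + cardMinus fullX ⊤            ≡⟨ cong (_+ cardMinus fullX ⊤) (ρA-def ⊤) ⟩
      r ⊤ + ∣ ⊤ ∩ A ∣ + cardMinus fullX ⊤ ≡⟨ cong₂ (λ U k → r ⊤ + ∣ U ∣ + k)
                                                   (∩-identityˡ A) (sumOut-⊤ (block fullX)) ⟩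
      r ⊤ + ∣ A ∣ + 0                     ≡⟨ +-identityʳ _ ⟩
      r ⊤ + ∣ A ∣                         ∎
    full-block : ∀ e → block fullX e ≡ indicator ⊤ e + indicator A e
    full-block e = begin-equality
      block fullX e            ≡⟨ countF-true (ρA ⁅ e ⁆) ⟩
      ρA ⁅ e ⁆                 ≡⟨ ρA-⁅⁆ e ⟩
      suc (indicator A e)      ≡⟨ cong (λ b → 𝟙 b + indicator A e) (sym (lookup-replicate e true)) ⟩
      indicator ⊤ e + indicator A e ∎
    lower : ∀ D → r ⊤ + ∣ A ∣ ≤ ρA D + cardMinus fullX D
    lower D = begin
      r ⊤ + ∣ A ∣                                     ≡⟨ cong (r ⊤ +_) (∣∣≡∣∩∣+∣─∣ D A) ⟩
      r ⊤ + (∣ D ∩ A ∣ + ∣ A ─ D ∣)                   ≤⟨ +-monoˡ-≤ _ (r≤r∩+∣─∣ D ⊤) ⟩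
      r (D ∩ ⊤) + ∣ ⊤ ─ D ∣ + (∣ D ∩ A ∣ + ∣ A ─ D ∣) ≡⟨ interchange (r (D ∩ ⊤)) _ _ _ ⟩
      r (D ∩ ⊤) + ∣ D ∩ A ∣ + (∣ ⊤ ─ D ∣ + ∣ A ─ D ∣) ≡⟨ cong₂ (λ U k → r U + ∣ D ∩ A ∣ + k) (∩-identityʳ D) outside ⟩
      r D + ∣ D ∩ A ∣ + cardMinus fullX D             ≡⟨ cong (_+ cardMinus fullX D) (sym (ρA-def D)) ⟩
      ρA D + cardMinus fullX D                        ∎
      where
      outside : ∣ ⊤ ─ D ∣ + ∣ A ─ D ∣ ≡ cardMinus fullX D
      outside = begin-equality
        ∣ ⊤ ─ D ∣ + ∣ A ─ D ∣                             ≡⟨ cong₂ _+_ (∣─∣≡sumOut ⊤ D) (∣─∣≡sumOut A D) ⟩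
        sumOut D (indicator ⊤) + sumOut D (indicator A)   ≡⟨ sym (sumOut-+ D (indicator ⊤) (indicator A)) ⟩
        sumOut D (λ e → indicator ⊤ e + indicator A e)    ≡⟨ sumF-cong (λ e → cong (if lookup D e then 0 else_) (sym (full-block e))) ⟩
        cardMinus fullX D                                 ∎

  module _ (S : SubsetX) where

    private
      b  = block S
      S' = S′ S

    lookup-S′ : ∀ e → lookup S' e ≡ (b e ≡ᵇ suc (indicator A e))
    lookup-S′ e = trans (lookup∘tabulate _ e) (cong (b e ≡ᵇ_) (ρA-⁅⁆ e))

    block-≤1+𝟙 : ∀ e → b e ≤ suc (indicator A e)
    block-≤1+𝟙 e = subst (b e ≤_) (ρA-⁅⁆ e) (countF-≤ _)

    block-≤ : ∀ e → b e ≤ indicator S' e + indicator A e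
    block-≤ e = subst (λ full → b e ≤ 𝟙 full + indicator A e) (sym (lookup-S′ e))
                      (≤1+𝟙⇒≤𝟙≡ᵇ+𝟙 (lookup A e) (b e) (block-≤1+𝟙 e))

    block-≡⇔ : ∀ e → b e ≡ indicator S' e + indicator A e ⇔ (lookup A e ≡ true → 0 < b e)
    block-≡⇔ e = subst (λ full → b e ≡ 𝟙 full + indicator A e ⇔ (lookup A e ≡ true → 0 < b e))
                       (sym (lookup-S′ e)) (≤1+𝟙⇒≡𝟙≡ᵇ+𝟙⇔ (lookup A e) (b e) (block-≤1+𝟙 e))

    sumF-indicators : sumF (λ e → indicator S' e + indicator A e) ≡ ∣ S' ∣ + ∣ A ∣
    sumF-indicators = trans (sumF-+ (indicator S') (indicator A)) (sym (cong₂ _+_ (∣∣≡sumF S') (∣∣≡sumF A)))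

    card≤∣S′∣+∣A∣ : card S ≤ ∣ S' ∣ + ∣ A ∣
    card≤∣S′∣+∣A∣ = subst (card S ≤_) sumF-indicators (sumF-mono-≤ block-≤)

    card≡∣S′∣+∣A∣⇔ : card S ≡ ∣ S' ∣ + ∣ A ∣ ⇔ (∀ e → lookup A e ≡ true → 0 < b e)
    card≡∣S′∣+∣A∣⇔ = mk⇔ to from
      where
      to : card S ≡ ∣ S' ∣ + ∣ A ∣ → ∀ e → lookup A e ≡ true → 0 < b e
      to eq e = Equivalence.to (block-≡⇔ e) (sumF-≡⇒≡ block-≤ (trans eq (sym sumF-indicators)) e)
      from : (∀ e → lookup A e ≡ true → 0 < b e) → card S ≡ ∣ S' ∣ + ∣ A ∣
      from nonempty = trans (sumF-cong λ e → Equivalence.from (block-≡⇔ e) (nonempty e)) sumF-indicators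

    sumIn-S′ : sumIn S' b ≡ ∣ S' ∣ + ∣ S' ∩ A ∣
    sumIn-S′ = begin
      sumIn S' b                                       ≡⟨ sumIn-cong S' full ⟩
      sumIn S' (λ e → 1 + indicator A e)               ≡⟨ sumIn-+ S' (λ _ → 1) (indicator A) ⟩
      sumIn S' (λ _ → 1) + sumIn S' (indicator A)      ≡⟨ sym (cong₂ _+_ (∣∣≡sumF S') (∣∩∣≡sumIn S' A)) ⟩
      ∣ S' ∣ + ∣ S' ∩ A ∣                              ∎
      where
      open ≡-Reasoning
      full : ∀ e → lookup S' e ≡ true → b e ≡ suc (indicator A e)
      full e S'e = ≡ᵇ⇒≡ (b e) _ (Equivalence.from Bool.T-≡ (trans (sym (lookup-S′ e)) S'e))

    independent⇔S′ : Independent S ⇔ (r S' ≡ ∣ S' ∣)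
    independent⇔S′ = ⇔-trans (independent⇔sumIn≤ρ ρA-⊥ S) (mk⇔ to from)
      where
      open ≤-Reasoning
      to : (∀ D → sumIn D b ≤ ρA D) → r S' ≡ ∣ S' ∣
      to fits = ≤-antisym (bounded S')
        (+-cancelʳ-≤ ∣ S' ∩ A ∣ ∣ S' ∣ (r S') (subst₂ _≤_ sumIn-S′ (ρA-def S') (fits S')))
      from : r S' ≡ ∣ S' ∣ → ∀ D → sumIn D b ≤ ρA D
      from indep D = begin
        sumIn D b                                       ≤⟨ sumIn-mono-≤ D block-≤ ⟩
        sumIn D (λ e → indicator S' e + indicator A e)  ≡⟨ sumIn-+ D (indicator S') (indicator A) ⟩
        sumIn D (indicator S') + sumIn D (indicator A)  ≡⟨ sym (cong₂ _+_ (∣∩∣≡sumIn D S') (∣∩∣≡sumIn D A)) ⟩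
        ∣ D ∩ S' ∣ + ∣ D ∩ A ∣                          ≤⟨ +-monoˡ-≤ ∣ D ∩ A ∣ (independent⇒∣∩∣≤r indep D) ⟩
        r D + ∣ D ∩ A ∣                                 ≡⟨ sym (ρA-def D) ⟩
        ρA D                                            ∎

    covers⇔ : (∀ e → e ∈ A → ∃[ i ] S (e , i) ≡ true) ⇔ (∀ e → lookup A e ≡ true → 0 < b e)
    covers⇔ = mk⇔
      (λ covers e Ae → Equivalence.from (0<countF⇔∃ _) (covers e (lookup⇒[]= e A Ae)))
      (λ nonempty e e∈A → Equivalence.to (0<countF⇔∃ _) (nonempty e ([]=⇒lookup e∈A)))

    basis⇔ : Basis S ⇔ ((r S' ≡ ∣ S' ∣ × r S' ≡ r ⊤) × (∀ e → e ∈ A → ∃[ i ] S (e , i) ≡ true))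
    basis⇔ = mk⇔ to from
      where
      tight⇔ : r S' ≡ ∣ S' ∣ → card S ≡ r ⊤ + ∣ A ∣ ⇔ (∣ S' ∣ ≡ r ⊤ × card S ≡ ∣ S' ∣ + ∣ A ∣)
      tight⇔ indep = ≤+≤-tight⇔ card≤∣S′∣+∣A∣ (subst (_≤ r ⊤) indep (monotone ⊆⊤))
      to : Basis S → (r S' ≡ ∣ S' ∣ × r S' ≡ r ⊤) × (∀ e → e ∈ A → ∃[ i ] S (e , i) ≡ true)
      to (indepS , spanning) =
        let indep = Equivalence.to independent⇔S′ indepS
            ∣S'∣≡r⊤ , card≡ = Equivalence.to (tight⇔ indep) (trans (sym indepS) (trans spanning rank-fullX))
        in (indep , trans indep ∣S'∣≡r⊤) , Equivalence.from covers⇔ (Equivalence.to card≡∣S′∣+∣A∣⇔ card≡)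
      from : (r S' ≡ ∣ S' ∣ × r S' ≡ r ⊤) × (∀ e → e ∈ A → ∃[ i ] S (e , i) ≡ true) → Basis S
      from ((indep , r≡r⊤) , covers) =
        let indepS = Equivalence.from independent⇔S′ indep
            card≡ = Equivalence.from (tight⇔ indep)
                      (trans (sym indep) r≡r⊤ , Equivalence.from card≡∣S′∣+∣A∣⇔ (Equivalence.to covers⇔ covers))
        in indepS , trans indepS (trans card≡ (sym rank-fullX))

allSubset? : ∀ {n} {P : Subset n → Set} → Decidable P → Dec (∀ X → P X)
allSubset? {zero}  P? = map′ (λ { p [] → p }) (λ all → all []) (P? [])
allSubset? {suc n} P? =
  map′ (λ { (ins , outs) (true ∷ X) → ins X ; (ins , outs) (false ∷ X) → outs X })
       (λ all → all ∘ (true ∷_) , all ∘ (false ∷_))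
       (allSubset? (P? ∘ (true ∷_)) ×-dec allSubset? (P? ∘ (false ∷_)))

-- Edges are numbered as in K4ends: 01, 02, 03, 12, 13, 23.
triangles : List (Subset 6)
triangles = (true  ∷ true  ∷ false ∷ true  ∷ false ∷ false ∷ [])
          ∷ (true  ∷ false ∷ true  ∷ false ∷ true  ∷ false ∷ [])
          ∷ (false ∷ true  ∷ true  ∷ false ∷ false ∷ true  ∷ [])
          ∷ (false ∷ false ∷ false ∷ true  ∷ true  ∷ true  ∷ [])
          ∷ []

rankK4 : Subset 6 → ℕ
rankK4 X = ∣ X ∣ ⊓ 3 ∸ 𝟙 (any (λ T → ⌊ ≡-dec Bool._≟_ X T ⌋) triangles)

MK4-rank≗rankK4 : ∀ X → MK4.rank X ≡ rankK4 X
MK4-rank≗rankK4 = toWitness {a? = allSubset? λ X → MK4.rank X ≟ rankK4 X} _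

rankK4-isMatroidRank : IsMatroidRank rankK4
rankK4-isMatroidRank = record
  { bounded    = toWitness {a? = allSubset? λ X → rankK4 X ≤? ∣ X ∣} _
  ; monotone   = λ {X} {Y} → toWitness {a? = allSubset? λ X → allSubset? λ Y →
                   (X ⊆? Y) →-dec (rankK4 X ≤? rankK4 Y)} _ X Y
  ; submodular = toWitness {a? = allSubset? λ X → allSubset? λ Y →
                   rankK4 (X ∪ Y) + rankK4 (X ∩ Y) ≤? rankK4 X + rankK4 Y} _
  }

MK4-isMatroidRank : IsMatroidRank MK4.rank
MK4-isMatroidRank = IsMatroidRank-cong (sym ∘ MK4-rank≗rankK4) rankK4-isMatroidRank

MK4-loopless : ∀ e → MK4.rank ⁅ e ⁆ ≡ 1
MK4-loopless = toWitness {a? = all? λ e → MK4.rank ⁅ e ⁆ ≟ 1} _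

lemma7p2 : (A : Subset 6) (S : NaturalMatroid.SubsetX (ρ A)) →
    (NaturalMatroid.Independent (ρ A) S ⇔ MK4.Independent (NaturalMatroid.S′ (ρ A) S))
    × (NaturalMatroid.Basis (ρ A) S ⇔
        (MK4.Basis (NaturalMatroid.S′ (ρ A) S)
          × ((e : Fin 6) → e ∈ A → ∃[ i ] (S (e , i) ≡ true))))
lemma7p2 A S = independent⇔S′ S , basis⇔ S
  where open NaturalMatroidOfRankPlusCount MK4-isMatroidRank MK4-loopless A (ρ A) (λ _ → refl)
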